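{- In Church's typed intensional language, the theory consisting of Typed Sense Determines Reference, Typed Composition, the Surjectivity Axiom, the Senses are Objects Axiom, and the Predicative Typed Choice Schema proves that there exists a sense-selecting extension operator, i.e. an entity $\partial$ of type $(et)e$ such that $\partial$ is injective ($\partial(f)=\partial(g)\rightarrow f=g$ for $f,g$ of type $et$) and for every $f$ of type $et$ there is $f'$ of type $(et)'$ with $\Delta_{et}(f')=f$ and $f'=\partial(f)$.
   Context: Types: $e,t$ are types; if $a,b$ are types so are $ab$ and $a'$ ($a\mapsto a'$ primitive). Degree: $\|e\|=\|t\|=1$, $\|a'\|=\|a\|$, $\|ab\|=\|a\|+1$ if $\|a\|\ge\|b\|$, $\|ab\|=\|b\|$ if $\|a\|<\|b\|$. The language is many-sorted with one sort per type, constants $0,1$ of type $t$, extensional application $f(x)$, binary relations $\Delta_a$ between types $a'$ and $a$ written $\Delta_a(f')=f$, ternary intensional-application relations between types $(ab)',a',b'$ written $f'\langle x'\rangle=y'$, and untyped identity (so a variable of type $(et)'$ may be equated with one of type $e$). Axioms: Typed Sense Determines Reference: $\Delta_a(f')=d_0\wedge\Delta_a(f')=d_1\rightarrow d_0=d_1$. Typed Composition: if $\Delta_{ab}(f')=f$ and $\Delta_a(x')=x$ then $f'\langle x'\rangle$ is defined and $\Delta_b(f'\langle x'\rangle)=f(x)$. Surjectivity: every $f$ of type $a$ has $f'$ of type $a'$ with $\Delta_a(f')=f$. Senses are Objects: every entity of type $a'$ is identical to some entity of type $e$. Predicative Typed Choice Schema: $\forall\vec z\,[(\forall x\,\exists y\,\varphi(x,y,\vec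 z))\rightarrow\exists h\,\forall x\,\varphi(x,h(x),\vec z)]$ for any formula $\varphi$ with all free variables displayed, $x$ of type $a$, $y$ of type $b$, $h$ of type $ab$ not free in $\varphi$, each parameter $z_i$ of a type of degree $\le\|ab\|$, and all bound variables of $\varphi$ of types of degree $<\|ab\|$. -}

module Defs where

open import Data.Nat using (ℕ; suc; _≤_; _<_; _≤ᵇ_)
open import Data.Bool using (if_then_else_)
open import Data.List using (List; []; _∷_)
open import Data.List.Membership.Propositional using (_∈_)
open import Data.List.Relation.Unary.All using (All; []; _∷_; lookup)
open import Data.Product using (Σ; _×_; _,_; proj₁; proj₂)
open import Data.Sum using (_⊎_)
open import Data.Empty using (⊥)
open import Data.Unit using (⊤)
open import Relation.Binary.PropositionalEquality using (_≡_)

-- Types of Church's typed intensional language.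
--   e, t         base types
--   a ⇒ b        the type written "ab" in the paper (functions from a to b)
--   a ′          the type written "a'" (senses of entities of type a)

infixr 20 _⇒_
infix 30 _′

data Ty : Set where
  e t  : Ty
  _⇒_  : Ty → Ty → Ty
  _′   : Ty → Ty

deg : Ty → ℕ
deg e = 1
deg t = 1
deg (a ′) = deg a
deg (a ⇒ b) = if deg b ≤ᵇ deg a then suc (deg a) else deg b

-- All entities live in a common universe U (so that the untyped identity
-- between entities of different sorts is just ≡ on U); `Has a u` says that
-- u is an entity of sort a.

record Structure : Set₁ where
  field
    U     : Set
    Has   : Ty → U → Set
    inhabited : (a : Ty) → Σ U (Has a)
    zero one : U
    zero-t   : Has t zero
    one-t    : Has t one
    app   : U → U → U
    app-typed : ∀ {a b f x} → Has (a ⇒ b) f → Has a x → Has b (app f x)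
    Δ     : Ty → U → U → Set                      -- Δ a f' f  :  Δ_a(f') = f
    IApp  : Ty → Ty → U → U → U → Set             -- IApp a b f' x' y' : f'⟨x'⟩ = y'
                                                  --  (f' : (ab)', x' : a', y' : b')

-- Syntax of formulas (needed for the choice schema).  Typed de Bruijn
-- variables: a context is a list of types, var 0 is the head.

Ctx : Set
Ctx = List Ty

data Tm (Γ : Ctx) : Ty → Set where
  var  : ∀ {a} → a ∈ Γ → Tm Γ a
  `0   : Tm Γ t
  `1   : Tm Γ t
  _·_  : ∀ {a b} → Tm Γ (a ⇒ b) → Tm Γ a → Tm Γ b

data Fm (Γ : Ctx) : Set where
  _≐_   : ∀ {a b} → Tm Γ a → Tm Γ b → Fm Γ
  Δ[_]  : ∀ a → Tm Γ (a ′) → Tm Γ a → Fm Γ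
  IA[_,_] : ∀ a b → Tm Γ ((a ⇒ b) ′) → Tm Γ (a ′) → Tm Γ (b ′) → Fm Γ
  `⊥    : Fm Γ
  _`∧_ _`∨_ _`→_ : Fm Γ → Fm Γ → Fm Γ
  `∀[_] `∃[_] : ∀ a → Fm (a ∷ Γ) → Fm Γ

BoundBelow : ∀ {Γ} → ℕ → Fm Γ → Set
BoundBelow n (_ ≐ _) = ⊤
BoundBelow n (Δ[ _ ] _ _) = ⊤
BoundBelow n (IA[ _ , _ ] _ _ _) = ⊤
BoundBelow n `⊥ = ⊤
BoundBelow n (φ `∧ ψ) = BoundBelow n φ × BoundBelow n ψ
BoundBelow n (φ `∨ ψ) = BoundBelow n φ × BoundBelow n ψ
BoundBelow n (φ `→ ψ) = BoundBelow n φ × BoundBelow n ψ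
BoundBelow n (`∀[ a ] φ) = deg a < n × BoundBelow n φ
BoundBelow n (`∃[ a ] φ) = deg a < n × BoundBelow n φ

module Semantics (M : Structure) where
  open Structure M

  Elem : Ty → Set
  Elem a = Σ U (Has a)

  Env : Ctx → Set
  Env Γ = All Elem Γ

  ⟦_⟧ : ∀ {Γ a} → Tm Γ a → Env Γ → U
  ⟦ var x ⟧ ρ = proj₁ (lookup ρ x)
  ⟦ `0 ⟧ ρ = zero
  ⟦ `1 ⟧ ρ = one
  ⟦ s · u ⟧ ρ = app (⟦ s ⟧ ρ) (⟦ u ⟧ ρ)

  ⟦_⟧-typed : ∀ {Γ a} (s : Tm Γ a) (ρ : Env Γ) → Has a (⟦ s ⟧ ρ)
  ⟦ var x ⟧-typed ρ = proj₂ (lookup ρ x)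
  ⟦ `0 ⟧-typed ρ = zero-t
  ⟦ `1 ⟧-typed ρ = one-t
  ⟦ s · u ⟧-typed ρ = app-typed (⟦ s ⟧-typed ρ) (⟦ u ⟧-typed ρ)

  Sat : ∀ {Γ} → Fm Γ → Env Γ → Set
  Sat (s ≐ u) ρ = ⟦ s ⟧ ρ ≡ ⟦ u ⟧ ρ
  Sat (Δ[ a ] s u) ρ = Δ a (⟦ s ⟧ ρ) (⟦ u ⟧ ρ)
  Sat (IA[ a , b ] f x y) ρ = IApp a b (⟦ f ⟧ ρ) (⟦ x ⟧ ρ) (⟦ y ⟧ ρ)
  Sat `⊥ ρ = ⊥
  Sat (φ `∧ ψ) ρ = Sat φ ρ × Sat ψ ρ
  Sat (φ `∨ ψ) ρ = Sat φ ρ ⊎ Sat ψ ρ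
  Sat (φ `→ ψ) ρ = Sat φ ρ → Sat ψ ρ
  Sat (`∀[ a ] φ) ρ = (x : Elem a) → Sat φ (x ∷ ρ)
  Sat (`∃[ a ] φ) ρ = Σ (Elem a) λ x → Sat φ (x ∷ ρ)

module Axioms (M : Structure) where
  open Structure M
  open Semantics M

  SenseDeterminesReference : Set
  SenseDeterminesReference =
    ∀ a (f' : Elem (a ′)) (d₀ d₁ : Elem a) →
    Δ a (proj₁ f') (proj₁ d₀) → Δ a (proj₁ f') (proj₁ d₁) → proj₁ d₀ ≡ proj₁ d₁

  Composition : Set
  Composition =
    ∀ a b (f' : Elem ((a ⇒ b) ′)) (f : Elem (a ⇒ b)) (x' : Elem (a ′)) (x : Elem a) →
    Δ (a ⇒ b) (proj₁ f') (proj₁ f) → Δ a (proj₁ x') (proj₁ x) →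
      Σ (Elem (b ′)) (λ y' → IApp a b (proj₁ f') (proj₁ x') (proj₁ y'))
    × (∀ (y' : Elem (b ′)) → IApp a b (proj₁ f') (proj₁ x') (proj₁ y') →
         Δ b (proj₁ y') (app (proj₁ f) (proj₁ x)))

  Surjectivity : Set
  Surjectivity = ∀ a (f : Elem a) → Σ (Elem (a ′)) λ f' → Δ a (proj₁ f') (proj₁ f)

  SensesAreObjects : Set
  SensesAreObjects = ∀ a (f' : Elem (a ′)) → Σ (Elem e) λ y → proj₁ f' ≡ proj₁ y

  -- Predicative Typed Choice Schema.  φ(x, y, z⃗) has context y ∷ x ∷ Γ
  -- (y = var 0 of type b, x = var 1 of type a, z⃗ = Γ); h of type ab is not
  -- free in φ automatically.
  PredicativeChoice : Set
  PredicativeChoice =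
    ∀ (a b : Ty) (Γ : Ctx) (φ : Fm (b ∷ a ∷ Γ)) →
    All (λ c → deg c ≤ deg (a ⇒ b)) Γ →
    BoundBelow (deg (a ⇒ b)) φ →
    (ρ : Env Γ) →
    ((x : Elem a) → Σ (Elem b) λ y → Sat φ (y ∷ x ∷ ρ)) →
    Σ (Elem (a ⇒ b)) λ h →
      (x : Elem a) →
      Sat φ ((app (proj₁ h) (proj₁ x) , app-typed (proj₂ h) (proj₂ x)) ∷ x ∷ ρ)

record IsModel (M : Structure) : Set where
  open Axioms M
  field
    sdr       : SenseDeterminesReference
    comp      : Composition
    surj      : Surjectivity
    senseObj  : SensesAreObjects
    choice    : PredicativeChoice

module _ (M : Structure) where
  open Structure M
  open Semantics M

  SenseSelectingExtensionOperator : Elem ((e ⇒ t) ⇒ e) → Set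
  SenseSelectingExtensionOperator ∂ =
      (∀ (f g : Elem (e ⇒ t)) →
         app (proj₁ ∂) (proj₁ f) ≡ app (proj₁ ∂) (proj₁ g) → proj₁ f ≡ proj₁ g)
    × (∀ (f : Elem (e ⇒ t)) → Σ (Elem ((e ⇒ t) ′)) λ f' →
         Δ (e ⇒ t) (proj₁ f') (proj₁ f) × proj₁ f' ≡ app (proj₁ ∂) (proj₁ f))

  ExistsSenseSelectingExtensionOperator : Set
  ExistsSenseSelectingExtensionOperator =
    Σ (Elem ((e ⇒ t) ⇒ e)) SenseSelectingExtensionOperator

-- By Surjectivity every f of type a has a sense f', and by Senses are Objects f' is an
-- entity of type e; so ∀f ∃y (∃f' (Δ(f') = f ∧ f' = y)) holds.  This formula quantifies
-- only over the type a′, whose degree is below that of a ⇒ e, so Predicative Choice turns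
-- it into a function ∂ of type a ⇒ e selecting a sense ∂(f) of each f.  Injectivity of ∂
-- is then Sense Determines Reference: ∂(f) = ∂(g) is a common sense of f and g.
module Submission where

open import Defs
open import Data.Nat using (suc; _≤_; _<_; _≤ᵇ_; s≤s; z≤n)
open import Data.Nat.Properties using (≤-refl)
open import Data.Bool using (true; false)
open import Data.List using (List)
open import Data.List.Relation.Unary.Any using (here; there)
open import Data.List.Relation.Unary.All using ([]; _∷_)
open import Data.Product using (Σ; _×_; _,_; proj₁; proj₂)
open import Data.Unit using (tt)
open import Relation.Binary.PropositionalEquality using (_≡_; refl; sym; trans; subst)

deg-positive : ∀ a → 1 ≤ deg a
deg-positive e = s≤s z≤n
deg-positive t = s≤s z≤n
deg-positive (a ′) = deg-positive a
deg-positive (a ⇒ b) with deg b ≤ᵇ deg a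
... | true  = s≤s z≤n
... | false = deg-positive b

deg-⇒e : ∀ a → deg (a ⇒ e) ≡ suc (deg a)
deg-⇒e a with deg a | deg-positive a
... | suc _ | _ = refl

deg-′<deg-⇒e : ∀ a → deg (a ′) < deg (a ⇒ e)
deg-′<deg-⇒e a rewrite deg-⇒e a = ≤-refl

-- In context y : e, x : a the formula ∃f' : a′ (Δ_a(f') = x ∧ f' = y).
isSenseOf : ∀ a → Fm (e List.∷ a List.∷ List.[])
isSenseOf a = `∃[ a ′ ] (Δ[ a ] (var (here refl)) (var (there (there (here refl))))
                        `∧ (var (here refl) ≐ var (there (here refl))))

isSenseOf-predicative : ∀ a → BoundBelow (deg (a ⇒ e)) (isSenseOf a)
isSenseOf-predicative a = deg-′<deg-⇒e a , tt , tt

module _ (M : Structure) (isModel : IsModel M) where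
  open Structure M
  open Semantics M
  open IsModel isModel

  SelectsSenses : ∀ a → Elem (a ⇒ e) → Set
  SelectsSenses a ∂ = ∀ (f : Elem a) → Σ (Elem (a ′)) λ f' →
    Δ a (proj₁ f') (proj₁ f) × proj₁ f' ≡ app (proj₁ ∂) (proj₁ f)

  sense-as-object : ∀ a (f : Elem a) → Σ (Elem e) λ y → Sat (isSenseOf a) (y ∷ f ∷ [])
  sense-as-object a f with surj a f
  ... | f' , Δf'f with senseObj a f'
  ...   | y , f'≡y = y , f' , Δf'f , f'≡y

  sense-selector : ∀ a → Σ (Elem (a ⇒ e)) (SelectsSenses a)
  sense-selector a =
    choice a e List.[] (isSenseOf a) [] (isSenseOf-predicative a) [] (sense-as-object a)

  selector-injective : ∀ {a} (∂ : Elem (a ⇒ e)) → SelectsSenses a ∂ → ∀ (f g : Elem a) →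
    app (proj₁ ∂) (proj₁ f) ≡ app (proj₁ ∂) (proj₁ g) → proj₁ f ≡ proj₁ g
  selector-injective {a} ∂ selects f g ∂f≡∂g with selects f | selects g
  ... | f' , Δf'f , f'≡∂f | g' , Δg'g , g'≡∂g = sdr a f' f g Δf'f Δf'g
    where
    f'≡g' : proj₁ f' ≡ proj₁ g'
    f'≡g' = trans f'≡∂f (trans ∂f≡∂g (sym g'≡∂g))

    Δf'g : Δ a (proj₁ f') (proj₁ g)
    Δf'g = subst (λ u → Δ a u (proj₁ g)) (sym f'≡g') Δg'g

mainTheorem10 : (M : Structure) → IsModel M → ExistsSenseSelectingExtensionOperator M
mainTheorem10 M isModel with sense-selector M isModel (e ⇒ t)
... | ∂ , selects = ∂ , selector-injective M isModel ∂ selects , selects
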